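{- For all positive integers $n$ and all integers $k,\ell\geq 3$ we have $\mathrm{ex}_k(n,\mathbb{C}^{(k)}_\ell)\leq (k\ell-1)\binom{n}{k-1}$.
   Context: $\mathbb{C}^{(k)}_\ell$ is the $k$-uniform linear cycle of length $\ell$: $k$-sets $F_1,\dots,F_\ell$ and distinct vertices $v_1,\dots,v_\ell$ with $F_i\cap\{v_1,\dots,v_\ell\}=\{v_i,v_{i+1}\}$ (indices mod $\ell$) and the sets $F_i\setminus\{v_1,\dots,v_\ell\}$ pairwise disjoint. $\mathrm{ex}_k(n,H)$ is the maximum number of edges in a family of $k$-subsets of $[n]$ containing no copy of $H$. -}

module Defs where

open import Data.Nat using (ℕ; zero; suc)
open import Data.Nat.DivMod using (_mod_)
open import Data.Fin using (Fin; toℕ)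
open import Data.Fin.Subset using (Subset; _∈_; ∣_∣)
open import Data.List using (List)
open import Data.List.Membership.Propositional renaming (_∈_ to _∈ₗ_)
open import Data.List.Relation.Unary.All using (All)
open import Data.List.Relation.Unary.Unique.Propositional using (Unique)
open import Data.Product using (Σ; ∃; _×_)
open import Data.Sum using (_⊎_)
open import Function.Definitions using (Injective)
open import Relation.Binary.PropositionalEquality using (_≡_; _≢_)
open import Function.Bundles using (_⇔_)

next : ∀ {ℓ} → Fin ℓ → Fin ℓ
next {suc m} i = suc (toℕ i) mod (suc m)

record Family (n k : ℕ) : Set where
  field
    edges    : List (Subset n)
    distinct : Unique edges
    uniform  : All (λ A → ∣ A ∣ ≡ k) edges

open Family public

InCore : ∀ {n ℓ} → (Fin ℓ → Fin n) → Fin n → Set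
InCore v x = ∃ λ j → v j ≡ x

ContainsLinearCycle : ∀ {n k} → (ℓ : ℕ) → Family n k → Set
ContainsLinearCycle {n} ℓ 𝓕 =
  Σ (Fin ℓ → Subset n) λ F →
  Σ (Fin ℓ → Fin n) λ v →
    (∀ i → F i ∈ₗ edges 𝓕)
  × Injective _≡_ _≡_ v
  × (∀ i x → ((x ∈ F i) × InCore v x) ⇔ ((x ≡ v i) ⊎ (x ≡ v (next i))))
  × (∀ i j → i ≢ j → ∀ x → x ∈ F i → x ∈ F j → InCore v x)

module Submission where

open import Defs
open import Data.Nat using (ℕ; _*_; _∸_; _≤_)
open import Data.Nat.Combinatorics using (_C_)
open import Data.List using (length)
open import Relation.Nullary using (¬_)

-- Call a family K-degenerate if every nonempty subfamily H has an edge E and a point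
-- x ∈ E such that the (k − 1)-set E − x lies in fewer than K edges of H. Deleting the
-- fewer than K edges through such a set, after which it is never again of the form
-- E′ − x′, and repeating shows that a K-degenerate family has at most (K − 1) times as
-- many edges as there are (k − 1)-sets (degenerate-bound).
--
-- It remains to see that a C_ℓ-free k-uniform family is kℓ-degenerate, i.e. that a
-- nonempty family in which every E − x lies in at least K = kℓ edges contains C_ℓ
-- (module Dense). There any point of an edge can be exchanged for a new point avoiding
-- fewer than K − 1 prescribed points (fresh). Repeated exchanges first produce ℓ
-- distinct points, cyclically consecutive ones lying in a common edge (shadow-path,
-- close); then for each consecutive pair the other k − 2 points of a common edge are
-- exchanged for points avoiding the cycle and all previously chosen edges (link,
-- greedy-disjoint, cycle-links), and such links form a linear cycle (links-cycle).

open import Data.Nat using (zero; suc; _+_; _<_; z≤n; s≤s; s≤s⁻¹; _<?_)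
open import Data.Nat.Properties
open import Data.Nat.DivMod using (_%_; m<n⇒m%n≡m; n%n≡0)
open import Data.Nat.Combinatorics using (nCk+nC[k+1]≡[n+1]C[k+1])
open import Data.Nat.Induction using (<-wellFounded)
open import Induction.WellFounded using (Acc; acc)
import Data.Bool
open import Data.Bool using (true; false)
open import Data.Fin using (Fin; toℕ; inject₁; fromℕ) renaming (zero to fzero; suc to fsuc)
import Data.Fin.Properties as FinP
open import Data.Fin.Properties using (¬Fin0; toℕ-injective; toℕ-fromℕ<; toℕ-inject₁; toℕ-fromℕ; toℕ<n)
open import Data.Fin.Relation.Unary.Top using (view; ‵fromℕ; ‵inject₁)
open import Data.Fin.Subset using (Subset; _∈_; _∉_; ∣_∣; _⊆_; _∪_; ⁅_⁆; ⊥; _-_; Nonempty)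
open import Data.Fin.Subset.Properties
  using (nonempty?; Empty-unique; ∣⊥∣≡0; p─⊥≡p; p─q⊆p; x∈p∧x≢y⇒x∈p-y; drop-∷-⊆; drop-there;
         p⊆q⇒∣p∣≤∣q∣; x∈p∪q⁺; x∈⁅x⁆; _⊆?_; _∈?_)
open import Data.Vec using ([]; _∷_; here; there)
open import Data.Vec.Properties using (≡-dec)
open import Data.Vec.Functional using () renaming (_∷_ to _∷ᵥ_)
open import Data.List using (List; []; _∷_; map; filter; _++_; concat; tabulate)
open import Data.List.Properties using (length-map; length-removeAt′; length-++; length-tabulate; filter-notAll)
open import Data.List.Relation.Unary.Any as Any using (here; there; any?)
open import Data.List.Relation.Unary.All as All using (All; []; _∷_)
open import Data.List.Relation.Unary.All.Properties using (¬Any⇒All¬)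
open import Data.List.Relation.Unary.AllPairs using ([]; _∷_)
open import Data.List.Relation.Unary.Unique.Propositional using (Unique)
import Data.List.Relation.Unary.Unique.Propositional.Properties as Unique
open import Data.List.Membership.Propositional using (find; lose) renaming (_∈_ to _∈ₗ_; _∉_ to _∉ₗ_)
open import Data.List.Membership.Propositional.Properties
  using (∈-map⁺; ∈-filter⁺; ∈-filter⁻; ∈-++⁺ˡ; ∈-++⁺ʳ; ∈-tabulate⁺; ∈-concat⁺′)
import Data.List.Membership.DecPropositional as DecMembership
open import Data.List.Relation.Binary.Disjoint.Propositional using (Disjoint)
open import Data.Product using (Σ; ∃; _×_; _,_; proj₁; proj₂)
open import Data.Sum using (_⊎_; inj₁; inj₂)
open import Data.Empty using (⊥-elim)
open import Function using (case_of_)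
open import Function.Definitions using (Injective)
open import Function.Bundles using (_⇔_; mk⇔)
open import Relation.Nullary using (yes; no; ¬?)
open import Relation.Nullary.Decidable using (decidable-stable; _×-dec_)
open import Relation.Unary using (Decidable)
open import Relation.Binary.Definitions using (DecidableEquality)
open import Relation.Binary.PropositionalEquality

module _ {A : Set} where

  ∈-─ : ∀ {x z : A} (ys : List A) (x∈ : x ∈ₗ ys) → z ∈ₗ ys → z ≢ x → z ∈ₗ (ys Any.─ x∈)
  ∈-─ (y ∷ ys) (here refl) (here refl) z≢x = ⊥-elim (z≢x refl)
  ∈-─ (y ∷ ys) (here refl) (there z∈) z≢x = z∈
  ∈-─ (y ∷ ys) (there x∈) (here refl) z≢x = here refl
  ∈-─ (y ∷ ys) (there x∈) (there z∈) z≢x = there (∈-─ ys x∈ z∈ z≢x)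

  pigeonhole : ∀ {xs ys : List A} → Unique xs → (∀ {z} → z ∈ₗ xs → z ∈ₗ ys) → length xs ≤ length ys
  pigeonhole {[]} _ _ = z≤n
  pigeonhole {x ∷ xs} {ys} (x∉xs ∷ uxs) xs⊆ys =
    subst (suc (length xs) ≤_) (sym (length-removeAt′ ys (Any.index x∈ys)))
      (s≤s (pigeonhole uxs (λ z∈ → ∈-─ ys x∈ys (xs⊆ys (there z∈)) (λ z≡x → All.lookup x∉xs z∈ (sym z≡x)))))
    where
    x∈ys : x ∈ₗ ys
    x∈ys = xs⊆ys (here refl)

  length-concat-tabulate : ∀ {m d} (Ys : Fin m → List A) → (∀ i → length (Ys i) ≤ d) →
                           length (concat (tabulate Ys)) ≤ m * d
  length-concat-tabulate {zero} Ys short = z≤n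
  length-concat-tabulate {suc m} Ys short =
    subst (_≤ _) (sym (length-++ (Ys fzero)))
      (+-mono-≤ (short fzero) (length-concat-tabulate (λ i → Ys (fsuc i)) (λ i → short (fsuc i))))

  greedy-disjoint : ∀ {m} (d : ℕ) (P : Fin m → List A → Set) →
    (∀ i (X : List A) → length X ≤ m * d → ∃ λ Y → P i Y × length Y ≤ d × Disjoint Y X) →
    Σ (Fin m → List A) λ Ys →
      (∀ i → P i (Ys i) × length (Ys i) ≤ d) × (∀ {i j} → i ≢ j → Disjoint (Ys i) (Ys j))
  greedy-disjoint {zero} d P choose = (λ ()) , (λ ()) , λ {i} → ⊥-elim (¬Fin0 i)
  greedy-disjoint {suc m} d P choose
    with greedy-disjoint d (λ i → P (fsuc i)) (λ i X X≤ → choose (fsuc i) X (≤-trans X≤ (*-monoˡ-≤ d (n≤1+n m))))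
  ... | Ys′ , sat′ , disjoint′
    with choose fzero (concat (tabulate Ys′))
           (≤-trans (length-concat-tabulate Ys′ (λ i → proj₂ (sat′ i))) (*-monoˡ-≤ d (n≤1+n m)))
  ... | Y₀ , P₀ , short₀ , avoids₀ = Ys , sat , disjoint
    where
    Ys : Fin (suc m) → List A
    Ys fzero = Y₀
    Ys (fsuc i) = Ys′ i
    sat : ∀ i → P i (Ys i) × length (Ys i) ≤ d
    sat fzero = P₀ , short₀
    sat (fsuc i) = sat′ i
    avoids-later : ∀ j → Disjoint Y₀ (Ys′ j)
    avoids-later j (z∈ , z∈j) = avoids₀ (z∈ , ∈-concat⁺′ z∈j (∈-tabulate⁺ j))
    disjoint : ∀ {i j} → i ≢ j → Disjoint (Ys i) (Ys j)
    disjoint {fzero} {fzero} i≢j = ⊥-elim (i≢j refl)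
    disjoint {fzero} {fsuc j} _ = avoids-later j
    disjoint {fsuc i} {fzero} _ (z∈i , z∈0) = avoids-later i (z∈0 , z∈i)
    disjoint {fsuc i} {fsuc j} i≢j = disjoint′ (λ i≡j → i≢j (cong fsuc i≡j))

module _ {A : Set} (_≟_ : DecidableEquality A) where

  open DecMembership _≟_ using () renaming (_∈?_ to _∈ₗ?_)

  escape : ∀ {xs ys : List A} → Unique xs → length ys < length xs → ∃ λ x → x ∈ₗ xs × x ∉ₗ ys
  escape {xs} {ys} uxs ys<xs with any? (λ x → ¬? (x ∈ₗ? ys)) xs
  ... | yes some = find some
  ... | no none = ⊥-elim (<⇒≱ ys<xs (pigeonhole uxs all-in))
    where
    all-in : ∀ {z} → z ∈ₗ xs → z ∈ₗ ys
    all-in {z} z∈ = decidable-stable (z ∈ₗ? ys) (All.lookup (¬Any⇒All¬ xs none) z∈)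

cons-injective : ∀ {A : Set} {m} {y : A} {v : Fin m → A} →
  Injective _≡_ _≡_ v → (∀ j → y ≢ v j) → Injective _≡_ _≡_ (y ∷ᵥ v)
cons-injective inj new {fzero} {fzero} eq = refl
cons-injective inj new {fzero} {fsuc j} eq = ⊥-elim (new j eq)
cons-injective inj new {fsuc i} {fzero} eq = ⊥-elim (new i (sym eq))
cons-injective inj new {fsuc i} {fsuc j} eq = cong fsuc (inj eq)

∉-remove : ∀ {n} (p : Subset n) (x : Fin n) → x ∉ p - x
∉-remove (true ∷ p) fzero ()
∉-remove (false ∷ p) fzero ()
∉-remove (b ∷ p) (fsuc x) (there x∈) = ∉-remove p x x∈

∈-remove⁻ : ∀ {n} {p : Subset n} {x z} → z ∈ p - x → z ∈ p × z ≢ x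
∈-remove⁻ {p = p} {x} z∈ = p─q⊆p p ⁅ x ⁆ z∈ , λ { refl → ∉-remove p x z∈ }

card-remove : ∀ {n} {p : Subset n} {x} → x ∈ p → ∣ p ∣ ≡ suc ∣ p - x ∣
card-remove {p = true ∷ p} here = cong suc (sym (cong ∣_∣ (p─⊥≡p p)))
card-remove {p = true ∷ p} (there x∈) = cong suc (card-remove x∈)
card-remove {p = false ∷ p} (there x∈) = card-remove x∈

nonempty : ∀ {n} (p : Subset n) → 0 < ∣ p ∣ → Nonempty p
nonempty {n} p pos with nonempty? p
... | yes inhabited = inhabited
... | no empty = ⊥-elim (<-irrefl refl (subst (0 <_) (trans (cong ∣_∣ (Empty-unique empty)) (∣⊥∣≡0 n)) pos))

points : ∀ {n} m (E : Subset n) → m ≤ ∣ E ∣ → Σ (Fin m → Fin n) λ v → Injective _≡_ _≡_ v × (∀ i → v i ∈ E)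
points zero E _ = (λ ()) , (λ {i} → ⊥-elim (¬Fin0 i)) , λ ()
points (suc m) E m<∣E∣ with nonempty E (≤-trans (s≤s z≤n) m<∣E∣)
... | a , a∈E with points m (E - a) (s≤s⁻¹ (subst (suc m ≤_) (card-remove a∈E) m<∣E∣))
... | v , v-inj , v∈E-a = a ∷ᵥ v , cons-injective v-inj (λ j a≡vj → proj₂ (∈-remove⁻ (v∈E-a j)) (sym a≡vj)) , v∈E
  where
  v∈E : ∀ i → (a ∷ᵥ v) i ∈ E
  v∈E fzero = a∈E
  v∈E (fsuc j) = proj₁ (∈-remove⁻ (v∈E-a j))

unique-bound : ∀ {n} {ys : List (Fin n)} (C : Subset n) → Unique ys → (∀ {z} → z ∈ₗ ys → z ∈ C) →
               length ys ≤ ∣ C ∣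
unique-bound {ys = []} C _ _ = z≤n
unique-bound {ys = y ∷ ys} C (y∉ys ∷ uys) ys⊆C =
  subst (suc (length ys) ≤_) (sym (card-remove (ys⊆C (here refl))))
    (s≤s (unique-bound (C - y) uys (λ z∈ → x∈p∧x≢y⇒x∈p-y (ys⊆C (there z∈)) (λ z≡y → All.lookup y∉ys z∈ (sym z≡y)))))

⊆-card-≡ : ∀ {n} (A B : Subset n) → A ⊆ B → ∣ B ∣ ≡ ∣ A ∣ → B ≡ A
⊆-card-≡ [] [] _ _ = refl
⊆-card-≡ (true ∷ A) (true ∷ B) A⊆B eq = cong (true ∷_) (⊆-card-≡ A B (drop-∷-⊆ A⊆B) (suc-injective eq))
⊆-card-≡ (false ∷ A) (false ∷ B) A⊆B eq = cong (false ∷_) (⊆-card-≡ A B (drop-∷-⊆ A⊆B) eq)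
⊆-card-≡ (true ∷ A) (false ∷ B) A⊆B eq with A⊆B here
... | ()
⊆-card-≡ (false ∷ A) (true ∷ B) A⊆B eq =
  ⊥-elim (<-irrefl (sym eq) (s≤s (p⊆q⇒∣p∣≤∣q∣ (drop-∷-⊆ A⊆B))))

∪-⊥ : ∀ {n} (A : Subset n) → A ∪ ⊥ ≡ A
∪-⊥ [] = refl
∪-⊥ (true ∷ A) = cong (true ∷_) (∪-⊥ A)
∪-⊥ (false ∷ A) = cong (false ∷_) (∪-⊥ A)

one-point-extension : ∀ {n} (A B : Subset n) → A ⊆ B → ∣ B ∣ ≡ suc ∣ A ∣ →
                      ∃ λ y → y ∉ A × B ≡ A ∪ ⁅ y ⁆
one-point-extension [] [] _ ()
one-point-extension (true ∷ A) (true ∷ B) A⊆B eq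
  with one-point-extension A B (drop-∷-⊆ A⊆B) (suc-injective eq)
... | y , y∉A , B≡ = fsuc y , (λ y∈ → y∉A (drop-there y∈)) , cong (true ∷_) B≡
one-point-extension (false ∷ A) (false ∷ B) A⊆B eq
  with one-point-extension A B (drop-∷-⊆ A⊆B) eq
... | y , y∉A , B≡ = fsuc y , (λ y∈ → y∉A (drop-there y∈)) , cong (false ∷_) B≡
one-point-extension (true ∷ A) (false ∷ B) A⊆B eq with A⊆B here
... | ()
one-point-extension (false ∷ A) (true ∷ B) A⊆B eq =
  fzero , (λ ()) , cong (true ∷_) (trans (⊆-card-≡ A B (drop-∷-⊆ A⊆B) (suc-injective eq)) (sym (∪-⊥ A)))

_≟ₛ_ : ∀ {n} → DecidableEquality (Subset n)
_≟ₛ_ = ≡-dec Data.Bool._≟_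

replace : ∀ {n} → Fin n → Fin n → Subset n → Subset n
replace x y E = (E - x) ∪ ⁅ y ⁆

∈-replace-new : ∀ {n} {x y : Fin n} {E} → y ∈ replace x y E
∈-replace-new {y = y} = x∈p∪q⁺ (inj₂ (x∈⁅x⁆ y))

∈-replace-kept : ∀ {n} {x y z : Fin n} {E} → z ∈ E → z ≢ x → z ∈ replace x y E
∈-replace-kept z∈ z≢x = x∈p∪q⁺ (inj₁ (x∈p∧x≢y⇒x∈p-y z∈ z≢x))

subsets : (n r : ℕ) → List (Subset n)
subsets zero zero = [] ∷ []
subsets zero (suc r) = []
subsets (suc n) zero = map (false ∷_) (subsets n zero)
subsets (suc n) (suc r) = map (false ∷_) (subsets n (suc r)) ++ map (true ∷_) (subsets n r)

length-subsets : ∀ n r → length (subsets n r) ≡ n C r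
length-subsets zero zero = refl
length-subsets zero (suc r) = refl
length-subsets (suc n) zero = trans (length-map _ (subsets n zero)) (length-subsets n zero)
length-subsets (suc n) (suc r) = begin
  length (map (false ∷_) (subsets n (suc r)) ++ map (true ∷_) (subsets n r))
    ≡⟨ length-++ (map (false ∷_) (subsets n (suc r))) ⟩
  length (map (false ∷_) (subsets n (suc r))) + length (map (true ∷_) (subsets n r))
    ≡⟨ cong₂ _+_ (length-map _ (subsets n (suc r))) (length-map _ (subsets n r)) ⟩
  length (subsets n (suc r)) + length (subsets n r)
    ≡⟨ cong₂ _+_ (length-subsets n (suc r)) (length-subsets n r) ⟩
  n C suc r + n C r
    ≡⟨ +-comm (n C suc r) (n C r) ⟩
  n C r + n C suc r
    ≡⟨ nCk+nC[k+1]≡[n+1]C[k+1] n r ⟩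
  suc n C suc r ∎
  where open ≡-Reasoning

∈-subsets : ∀ {n} r (A : Subset n) → ∣ A ∣ ≡ r → A ∈ₗ subsets n r
∈-subsets zero [] _ = here refl
∈-subsets (suc r) [] ()
∈-subsets zero (true ∷ A) ()
∈-subsets (suc r) (true ∷ A) eq =
  ∈-++⁺ʳ (map (false ∷_) (subsets _ (suc r))) (∈-map⁺ (true ∷_) (∈-subsets r A (suc-injective eq)))
∈-subsets zero (false ∷ A) eq = ∈-map⁺ (false ∷_) (∈-subsets zero A eq)
∈-subsets (suc r) (false ∷ A) eq = ∈-++⁺ˡ (∈-map⁺ (false ∷_) (∈-subsets (suc r) A eq))

toℕ-next : ∀ {m} (i : Fin (suc m)) → toℕ (next i) ≡ suc (toℕ i) % suc m
toℕ-next i = toℕ-fromℕ< _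

next-inject₁ : ∀ {m} (j : Fin m) → next (inject₁ j) ≡ fsuc j
next-inject₁ {m} j = toℕ-injective (begin
  toℕ (next (inject₁ j))        ≡⟨ toℕ-next (inject₁ j) ⟩
  suc (toℕ (inject₁ j)) % suc m ≡⟨ cong (λ t → suc t % suc m) (toℕ-inject₁ j) ⟩
  suc (toℕ j) % suc m           ≡⟨ m<n⇒m%n≡m (s≤s (toℕ<n j)) ⟩
  suc (toℕ j)                   ∎)
  where open ≡-Reasoning

next-fromℕ : ∀ m → next (fromℕ m) ≡ fzero
next-fromℕ m = toℕ-injective (begin
  toℕ (next (fromℕ m))        ≡⟨ toℕ-next (fromℕ m) ⟩
  suc (toℕ (fromℕ m)) % suc m ≡⟨ cong (λ t → suc t % suc m) (toℕ-fromℕ m) ⟩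
  suc m % suc m               ≡⟨ n%n≡0 (suc m) ⟩
  0                           ∎)
  where open ≡-Reasoning

inject₁≢suc : ∀ {m} (j : Fin m) → inject₁ j ≢ fsuc j
inject₁≢suc fzero ()
inject₁≢suc (fsuc j) eq = inject₁≢suc j (FinP.suc-injective eq)

next-moves : ∀ {m} (i : Fin (2 + m)) → next i ≢ i
next-moves {m} i with view i
... | ‵fromℕ = λ eq → case trans (sym (next-fromℕ (1 + m))) eq of λ ()
... | ‵inject₁ j = λ eq → inject₁≢suc j (sym (trans (sym (next-inject₁ j)) eq))

Adjacent : ∀ {n} → List (Subset n) → Fin n → Fin n → Set
Adjacent G u w = ∃ λ E → E ∈ₗ G × u ∈ E × w ∈ E

degree : ∀ {n} → List (Subset n) → Subset n → ℕ
degree G T = length (filter (T ⊆?_) G)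

-- A copy of the linear cycle in a list of edges; ContainsLinearCycle ℓ 𝓕 is
-- by definition LinearCycleIn ℓ (edges 𝓕).
LinearCycleIn : ∀ {n} (ℓ : ℕ) → List (Subset n) → Set
LinearCycleIn {n} ℓ G =
  Σ (Fin ℓ → Subset n) λ F →
  Σ (Fin ℓ → Fin n) λ v →
    (∀ i → F i ∈ₗ G)
  × Injective _≡_ _≡_ v
  × (∀ i x → ((x ∈ F i) × InCore v x) ⇔ ((x ≡ v i) ⊎ (x ≡ v (next i))))
  × (∀ i j → i ≢ j → ∀ x → x ∈ F i → x ∈ F j → InCore v x)

LinearCycleIn-mono : ∀ {n ℓ} {G H : List (Subset n)} → (∀ {E} → E ∈ₗ H → E ∈ₗ G) →
                     LinearCycleIn ℓ H → LinearCycleIn ℓ G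
LinearCycleIn-mono H⊆G (F , v , F∈H , rest) = F , v , (λ i → H⊆G (F∈H i)) , rest

module _ {n : ℕ} (G : List (Subset n)) where

  record Link (p q : Fin n) (Y : List (Fin n)) : Set where
    field
      edge    : Subset n
      edge∈G  : edge ∈ₗ G
      p∈      : p ∈ edge
      q∈      : q ∈ edge
      covered : ∀ z → z ∈ edge → z ≡ p ⊎ z ≡ q ⊎ z ∈ₗ Y

  record CycleLinks {ℓ} (v : Fin ℓ → Fin n) : Set where
    field
      extra     : Fin ℓ → List (Fin n)
      link-at   : ∀ i → Link (v i) (v (next i)) (extra i)
      off-cycle : ∀ i → Disjoint (extra i) (tabulate v)
      separate  : ∀ {i j} → i ≢ j → Disjoint (extra i) (extra j)

  -- Links for distinct points form a linear cycle: a point of a link lying on the cycle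
  -- is one of its two ends, and two links can only meet in points of the cycle.
  links-cycle : ∀ {ℓ} {v : Fin ℓ → Fin n} → Injective _≡_ _≡_ v → CycleLinks v → LinearCycleIn ℓ G
  links-cycle {ℓ} {v} v-inj links = F , v , (λ i → Link.edge∈G (link-at i)) , v-inj , characterise , shared-in-core
    where
    open CycleLinks links
    F : Fin ℓ → Subset n
    F i = Link.edge (link-at i)
    extra-off-core : ∀ i {x} → x ∈ₗ extra i → ¬ InCore v x
    extra-off-core i x∈ (j , vj≡x) = off-cycle i (x∈ , subst (_∈ₗ tabulate v) vj≡x (∈-tabulate⁺ {f = v} j))
    characterise : ∀ i x → ((x ∈ F i) × InCore v x) ⇔ ((x ≡ v i) ⊎ (x ≡ v (next i)))
    characterise i x = mk⇔ to from
      where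
      to : (x ∈ F i) × InCore v x → (x ≡ v i) ⊎ (x ≡ v (next i))
      to (x∈F , in-core) with Link.covered (link-at i) x x∈F
      ... | inj₁ x≡ = inj₁ x≡
      ... | inj₂ (inj₁ x≡) = inj₂ x≡
      ... | inj₂ (inj₂ x∈extra) = ⊥-elim (extra-off-core i x∈extra in-core)
      from : (x ≡ v i) ⊎ (x ≡ v (next i)) → (x ∈ F i) × InCore v x
      from (inj₁ refl) = Link.p∈ (link-at i) , i , refl
      from (inj₂ refl) = Link.q∈ (link-at i) , next i , refl
    shared-in-core : ∀ i j → i ≢ j → ∀ x → x ∈ F i → x ∈ F j → InCore v x
    shared-in-core i j i≢j x x∈Fi x∈Fj with Link.covered (link-at i) x x∈Fi | Link.covered (link-at j) x x∈Fj
    ... | inj₁ x≡ | _ = i , sym x≡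
    ... | inj₂ (inj₁ x≡) | _ = next i , sym x≡
    ... | inj₂ (inj₂ _) | inj₁ x≡ = j , sym x≡
    ... | inj₂ (inj₂ _) | inj₂ (inj₁ x≡) = next j , sym x≡
    ... | inj₂ (inj₂ x∈i) | inj₂ (inj₂ x∈j) = ⊥-elim (separate i≢j (x∈i , x∈j))

module Dense {n k K : ℕ} (G : List (Subset n)) (G-unique : Unique G)
  (G-uniform : All (λ E → ∣ E ∣ ≡ k) G)
  (G-dense : ∀ {E} → E ∈ₗ G → ∀ {x} → x ∈ E → K ≤ degree G (E - x)) where

  open DecMembership (FinP._≟_ {n}) using () renaming (_∈?_ to _∈F?_)

  -- Any point x of an edge E can be exchanged for a point y outside E and outside
  -- a prescribed list X, provided X has fewer than K - 1 entries: of the at least K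
  -- edges containing E - x, at most 1 + length X have the form replace x y E with y ∈ x ∷ X.
  fresh : ∀ {E x} → E ∈ₗ G → x ∈ E → (X : List (Fin n)) → 2 + length X ≤ K →
          ∃ λ y → y ∉ E × y ∉ₗ X × replace x y E ∈ₗ G
  fresh {E} {x} E∈G x∈E X X<K
    with escape _≟ₛ_ (Unique.filter⁺ ((E - x) ⊆?_) G-unique)
           (subst (_< degree G (E - x)) (sym (length-map (λ y → replace x y E) (x ∷ X)))
             (≤-trans X<K (G-dense E∈G x∈E)))
  ... | e , e∈supersets , e-new with ∈-filter⁻ ((E - x) ⊆?_) {xs = G} e∈supersets
  ... | e∈G , E-x⊆e
    with one-point-extension (E - x) e E-x⊆e
           (trans (All.lookup G-uniform e∈G) (trans (sym (All.lookup G-uniform E∈G)) (card-remove x∈E)))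
  ... | y , y∉E-x , refl = y , y∉E , (λ y∈X → not-candidate (there y∈X)) , e∈G
    where
    not-candidate : y ∉ₗ x ∷ X
    not-candidate y∈ = e-new (∈-map⁺ (λ y → replace x y E) y∈)
    y∉E : y ∉ E
    y∉E y∈E = y∉E-x (x∈p∧x≢y⇒x∈p-y y∈E (λ y≡x → not-candidate (here y≡x)))

  record ShadowPath (m : ℕ) : Set where
    field
      vertex    : Fin (3 + m) → Fin n
      injective : Injective _≡_ _≡_ vertex
      linked    : ∀ (i : Fin (2 + m)) → Adjacent G (vertex (inject₁ i)) (vertex (fsuc i))
      closer    : Subset n
      closer∈G  : closer ∈ₗ G
      first∈    : vertex fzero ∈ closer
      second∈   : vertex (fsuc fzero) ∈ closer
      last∈     : vertex (fromℕ (2 + m)) ∈ closer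

  path-start : ∀ {E} → E ∈ₗ G → 3 ≤ k → ShadowPath 0
  path-start {E} E∈G 3≤k = record
    { vertex = v ; injective = proj₁ (proj₂ three) ; linked = linked
    ; closer = E ; closer∈G = E∈G
    ; first∈ = v∈E fzero ; second∈ = v∈E (fsuc fzero) ; last∈ = v∈E (fromℕ 2) }
    where
    three : Σ (Fin 3 → Fin n) λ v → Injective _≡_ _≡_ v × (∀ i → v i ∈ E)
    three = points 3 E (subst (3 ≤_) (sym (All.lookup G-uniform E∈G)) 3≤k)
    v : Fin 3 → Fin n
    v = proj₁ three
    v∈E : ∀ i → v i ∈ E
    v∈E = proj₂ (proj₂ three)
    linked : ∀ (i : Fin 2) → Adjacent G (v (inject₁ i)) (v (fsuc i))
    linked i = E , E∈G , v∈E (inject₁ i) , v∈E (fsuc i)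

  -- Exchanging the second point of the closing edge for a fresh point y, and putting
  -- y in front, lengthens the path by one.
  path-extend : ∀ {m} → ShadowPath m → 5 + m ≤ K → ShadowPath (suc m)
  path-extend {m} P bound = record
    { vertex = y ∷ᵥ vertex
    ; injective = cons-injective injective y-new
    ; linked = λ { fzero → closer′ , closer′∈G , ∈-replace-new , first∈′ ; (fsuc i) → linked i }
    ; closer = closer′ ; closer∈G = closer′∈G
    ; first∈ = ∈-replace-new ; second∈ = first∈′ ; last∈ = last∈′ }
    where
    open ShadowPath P
    exchange : ∃ λ y → y ∉ closer × y ∉ₗ tabulate vertex × replace (vertex (fsuc fzero)) y closer ∈ₗ G
    exchange = fresh closer∈G second∈ (tabulate vertex)
                 (subst (λ l → 2 + l ≤ K) (sym (length-tabulate vertex)) bound)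
    y : Fin n
    y = proj₁ exchange
    closer′ : Subset n
    closer′ = replace (vertex (fsuc fzero)) y closer
    closer′∈G : closer′ ∈ₗ G
    closer′∈G = proj₂ (proj₂ (proj₂ exchange))
    y-new : ∀ j → y ≢ vertex j
    y-new j y≡ = proj₁ (proj₂ (proj₂ exchange)) (subst (_∈ₗ tabulate vertex) (sym y≡) (∈-tabulate⁺ {f = vertex} j))
    first∈′ : vertex fzero ∈ closer′
    first∈′ = ∈-replace-kept first∈ (λ eq → case injective eq of λ ())
    last∈′ : vertex (fromℕ (2 + m)) ∈ closer′
    last∈′ = ∈-replace-kept last∈ (λ eq → case injective eq of λ ())

  shadow-path : ∀ {E} → E ∈ₗ G → 3 ≤ k → ∀ m → 4 + m ≤ K → ShadowPath m
  shadow-path E∈G 3≤k zero _ = path-start E∈G 3≤k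
  shadow-path E∈G 3≤k (suc m) bound = path-extend (shadow-path E∈G 3≤k m (≤-trans (n≤1+n _) bound)) bound

  record ShadowCycle (ℓ : ℕ) : Set where
    field
      vertex    : Fin ℓ → Fin n
      injective : Injective _≡_ _≡_ vertex
      linked    : ∀ i → Adjacent G (vertex i) (vertex (next i))

  close : ∀ {m} → ShadowPath m → ShadowCycle (3 + m)
  close {m} P = record { vertex = vertex ; injective = injective ; linked = linked′ }
    where
    open ShadowPath P
    linked′ : ∀ i → Adjacent G (vertex i) (vertex (next i))
    linked′ i with view i
    ... | ‵fromℕ = subst (λ t → Adjacent G (vertex (fromℕ (2 + m))) (vertex t)) (sym (next-fromℕ (2 + m)))
                     (closer , closer∈G , last∈ , first∈)
    ... | ‵inject₁ j = subst (λ t → Adjacent G (vertex (inject₁ j)) (vertex t)) (sym (next-inject₁ j)) (linked j)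

  -- Intermediate stage of the search for a link through p and q avoiding X: an edge
  -- through p and q and a list of points of it that avoid X.
  record Partial (p q : Fin n) (X : List (Fin n)) : Set where
    field
      edge         : Subset n
      edge∈G       : edge ∈ₗ G
      p∈           : p ∈ edge
      q∈           : q ∈ edge
      good         : List (Fin n)
      all-distinct : Unique (p ∷ q ∷ good)
      good⊆        : ∀ {z} → z ∈ₗ good → z ∈ edge
      avoids       : Disjoint good X

  module _ {p q : Fin n} {X : List (Fin n)} (S : Partial p q X) where
    open Partial S

    edge-bound : ∀ {ys} → Unique ys → (∀ {w} → w ∈ₗ ys → w ∈ edge) → length ys ≤ k
    edge-bound {ys} ys-unique ys⊆ = subst (length ys ≤_) (All.lookup G-uniform edge∈G) (unique-bound edge ys-unique ys⊆)

    known⊆ : ∀ {w} → w ∈ₗ p ∷ q ∷ good → w ∈ edge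
    known⊆ (here refl) = p∈
    known⊆ (there (here refl)) = q∈
    known⊆ (there (there w∈)) = good⊆ w∈

    good-size : length good ≤ k ∸ 2
    good-size = m+n≤o⇒m≤o∸n (length good) (subst (_≤ k) (+-comm 2 (length good)) (edge-bound all-distinct known⊆))

    partial-size : ∀ {z} → z ∈ edge → z ∉ₗ p ∷ q ∷ good → 3 + length good ≤ k
    partial-size {z} z∈ z∉ = edge-bound (All.tabulate (λ w∈ z≡w → z∉ (subst (_∈ₗ _) (sym z≡w) w∈)) ∷ all-distinct)
                               λ { (here refl) → z∈ ; (there w∈) → known⊆ w∈ }

    partial-done : (∀ z → z ∈ edge → z ∈ₗ p ∷ q ∷ good) → Link G p q good
    partial-done all-known = record { edge = edge ; edge∈G = edge∈G ; p∈ = p∈ ; q∈ = q∈ ; covered = covered }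
      where
      covered : ∀ z → z ∈ edge → z ≡ p ⊎ z ≡ q ⊎ z ∈ₗ good
      covered z z∈ with all-known z z∈
      ... | here z≡p = inj₁ z≡p
      ... | there (here z≡q) = inj₂ (inj₁ z≡q)
      ... | there (there z∈good) = inj₂ (inj₂ z∈good)

    partial-step : ∀ {z} → z ∈ edge → z ∉ₗ p ∷ q ∷ good → 2 + length X ≤ K → Partial p q X
    partial-step {z} z∈ z∉ bound = record
      { edge = replace z y edge ; edge∈G = proj₂ (proj₂ (proj₂ exchange))
      ; p∈ = ∈-replace-kept p∈ (λ p≡z → z∉ (here (sym p≡z)))
      ; q∈ = ∈-replace-kept q∈ (λ q≡z → z∉ (there (here (sym q≡z))))
      ; good = y ∷ good ; all-distinct = distinct′ all-distinct ; good⊆ = good⊆′ ; avoids = avoids′ }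
      where
      exchange : ∃ λ y → y ∉ edge × y ∉ₗ X × replace z y edge ∈ₗ G
      exchange = fresh edge∈G z∈ X bound
      y : Fin n
      y = proj₁ exchange
      y∉edge : y ∉ edge
      y∉edge = proj₁ (proj₂ exchange)
      differs : ∀ {w} → w ∈ edge → w ≢ y
      differs w∈ w≡y = y∉edge (subst (_∈ edge) w≡y w∈)
      distinct′ : Unique (p ∷ q ∷ good) → Unique (p ∷ q ∷ y ∷ good)
      distinct′ ((p≢q ∷ p≢good) ∷ q≢good ∷ good-unique) =
        (p≢q ∷ differs p∈ ∷ p≢good) ∷ (differs q∈ ∷ q≢good)
        ∷ All.tabulate (λ w∈ y≡w → differs (good⊆ w∈) (sym y≡w)) ∷ good-unique
      good⊆′ : ∀ {w} → w ∈ₗ y ∷ good → w ∈ replace z y edge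
      good⊆′ (here refl) = ∈-replace-new
      good⊆′ (there w∈) = ∈-replace-kept (good⊆ w∈) (λ w≡z → z∉ (there (there (subst (_∈ₗ good) w≡z w∈))))
      avoids′ : Disjoint (y ∷ good) X
      avoids′ (here refl , y∈X) = proj₁ (proj₂ (proj₂ exchange)) y∈X
      avoids′ (there w∈ , w∈X) = avoids (w∈ , w∈X)

  -- Repeating the exchange at most k times yields a link through p and q whose
  -- remaining points avoid X.
  partial-finish : ∀ {p q X} → 2 + length X ≤ K → (r : ℕ) (S : Partial p q X) →
    k ≤ r + (2 + length (Partial.good S)) →
    ∃ λ Y → Link G p q Y × length Y ≤ k ∸ 2 × Disjoint Y X
  partial-finish {p} {q} {X} bound r S budget
    with FinP.any? (λ z → (z ∈? Partial.edge S) ×-dec ¬? (z ∈F? (p ∷ q ∷ Partial.good S)))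
  ... | no none = Partial.good S , partial-done S all-known , good-size S , Partial.avoids S
    where
    all-known : ∀ z → z ∈ Partial.edge S → z ∈ₗ p ∷ q ∷ Partial.good S
    all-known z z∈ = decidable-stable (z ∈F? (p ∷ q ∷ Partial.good S)) (λ z∉ → none (z , z∈ , z∉))
  ... | yes (z , z∈ , z∉) with r
  ...   | zero = ⊥-elim (<-irrefl refl (≤-trans (partial-size S z∈ z∉) budget))
  ...   | suc r′ = partial-finish bound r′ (partial-step S z∈ z∉ bound)
                     (subst (k ≤_) (sym (+-suc r′ (2 + length (Partial.good S)))) budget)

  link : ∀ {p q} → p ≢ q → Adjacent G p q → (X : List (Fin n)) → 2 + length X ≤ K →
         ∃ λ Y → Link G p q Y × length Y ≤ k ∸ 2 × Disjoint Y X
  link p≢q (E , E∈G , p∈ , q∈) X bound = partial-finish bound k start (m≤m+n k 2)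
    where
    start : Partial _ _ X
    start = record { edge = E ; edge∈G = E∈G ; p∈ = p∈ ; q∈ = q∈ ; good = []
                   ; all-distinct = (p≢q ∷ []) ∷ [] ∷ [] ; good⊆ = λ { () } ; avoids = λ { (() , _) } }

  -- A shadow cycle on ℓ ≥ 2 points can be linked: each pair of consecutive points
  -- gets an edge whose other k - 2 points avoid the cycle and the links chosen before;
  -- there are always fewer than K - 1 points to avoid.
  cycle-links : ∀ {m} (C : ShadowCycle (2 + m)) → 2 + ((2 + m) + (2 + m) * (k ∸ 2)) ≤ K →
                CycleLinks G (ShadowCycle.vertex C)
  cycle-links {m} C bound = record
    { extra = proj₁ chosen
    ; link-at = λ i → proj₁ (proj₁ (proj₁ (proj₂ chosen) i))
    ; off-cycle = λ i → proj₂ (proj₁ (proj₁ (proj₂ chosen) i))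
    ; separate = proj₂ (proj₂ chosen) }
    where
    open ShadowCycle C
    ℓ : ℕ
    ℓ = 2 + m
    Attached : Fin ℓ → List (Fin n) → Set
    Attached i Y = Link G (vertex i) (vertex (next i)) Y × Disjoint Y (tabulate vertex)
    avoid-bound : ∀ X → length X ≤ ℓ * (k ∸ 2) → 2 + length (tabulate vertex ++ X) ≤ K
    avoid-bound X X≤ =
      subst (λ l → 2 + l ≤ K) (sym (trans (length-++ (tabulate vertex)) (cong (_+ length X) (length-tabulate vertex))))
        (≤-trans (+-monoʳ-≤ 2 (+-monoʳ-≤ ℓ X≤)) bound)
    choose : ∀ i X → length X ≤ ℓ * (k ∸ 2) → ∃ λ Y → Attached i Y × length Y ≤ k ∸ 2 × Disjoint Y X
    choose i X X≤ with link (λ eq → next-moves i (sym (injective eq))) (linked i) (tabulate vertex ++ X) (avoid-bound X X≤)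
    ... | Y , L , short , disjoint =
      Y , (L , λ { (z∈Y , z∈core) → disjoint (z∈Y , ∈-++⁺ˡ z∈core) }) , short ,
      λ { (z∈Y , z∈X) → disjoint (z∈Y , ∈-++⁺ʳ (tabulate vertex) z∈X) }
    chosen : Σ (Fin ℓ → List (Fin n)) λ Ys →
               (∀ i → Attached i (Ys i) × length (Ys i) ≤ k ∸ 2) × (∀ {i j} → i ≢ j → Disjoint (Ys i) (Ys j))
    chosen = greedy-disjoint (k ∸ 2) Attached choose

  -- If K exceeds by two the number ℓ + ℓ (k - 2) of points of a linear ℓ-cycle, a
  -- nonempty family as above contains a linear ℓ-cycle for every ℓ ≥ 3.
  dense-cycle : ∀ {E ℓ} → E ∈ₗ G → 3 ≤ k → 3 ≤ ℓ → 2 + (ℓ + ℓ * (k ∸ 2)) ≤ K → LinearCycleIn ℓ G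
  dense-cycle {ℓ = suc (suc (suc m))} E∈G 3≤k (s≤s (s≤s (s≤s _))) bound =
    links-cycle G (ShadowCycle.injective cycle) (cycle-links cycle bound)
    where
    path-bound : 4 + m ≤ K
    path-bound = ≤-trans (s≤s (s≤s (s≤s (s≤s (≤-trans (m≤m+n m _) (n≤1+n _)))))) bound
    cycle : ShadowCycle (3 + m)
    cycle = close (shadow-path E∈G 3≤k m path-bound)

ShadowsIn : ∀ {n} → List (Subset n) → List (Subset n) → Set
ShadowsIn S G = ∀ {E} → E ∈ₗ G → ∀ {x} → x ∈ E → (E - x) ∈ₗ S

Degenerate : ∀ {n} → ℕ → List (Subset n) → Set
Degenerate {n} K G = ∀ {H : List (Subset n)} → (∀ {E} → E ∈ₗ H → E ∈ₗ G) → Unique H →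
  ∀ {E} → E ∈ₗ H → ∃ λ E′ → ∃ λ x → E′ ∈ₗ H × x ∈ E′ × degree H (E′ - x) < K

length-filter-split : ∀ {A : Set} {P : A → Set} (P? : Decidable P) (xs : List A) →
  length (filter P? xs) + length (filter (λ x → ¬? (P? x)) xs) ≡ length xs
length-filter-split P? [] = refl
length-filter-split P? (x ∷ xs) with P? x
... | yes _ = cong suc (length-filter-split P? xs)
... | no _ = trans (+-suc _ _) (cong suc (length-filter-split P? xs))

-- Deletion argument: remove the fewer than K edges through a sparse set T = E - x;
-- afterwards T is no longer a shadow, so each member of S is charged at most K - 1 edges.
degenerate-bound : ∀ {n K} (S G : List (Subset n)) → Acc _<_ (length S) → Unique G →
  ShadowsIn S G → Degenerate K G → length G ≤ (K ∸ 1) * length S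
degenerate-bound S [] _ _ _ _ = z≤n
degenerate-bound {n} {K} S G@(_ ∷ _) (acc smaller) G-unique shadows degenerate
  with degenerate (λ E∈ → E∈) G-unique (here refl)
... | E , x , E∈G , x∈E , sparse = begin
  length G                          ≡⟨ sym (length-filter-split (T ⊆?_) G) ⟩
  degree G T + length G′            ≤⟨ +-mono-≤ (∸-monoˡ-≤ 1 sparse) rest-bound ⟩
  (K ∸ 1) + (K ∸ 1) * length S′     ≡⟨ sym (*-suc (K ∸ 1) (length S′)) ⟩
  (K ∸ 1) * suc (length S′)         ≤⟨ *-monoʳ-≤ (K ∸ 1) S′<S ⟩
  (K ∸ 1) * length S                ∎
  where
  open ≤-Reasoning
  T : Subset n
  T = E - x
  G′ S′ : List (Subset n)
  G′ = filter (λ e → ¬? (T ⊆? e)) G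
  S′ = filter (λ s → ¬? (s ≟ₛ T)) S
  S′<S : length S′ < length S
  S′<S = filter-notAll (λ s → ¬? (s ≟ₛ T)) S (Any.map (λ T≡s s≢T → s≢T (sym T≡s)) (shadows E∈G x∈E))
  G′⊆G : ∀ {e} → e ∈ₗ G′ → e ∈ₗ G
  G′⊆G e∈ = proj₁ (∈-filter⁻ (λ e → ¬? (T ⊆? e)) {xs = G} e∈)
  G′-shadows : ShadowsIn S′ G′
  G′-shadows {e} e∈ {y} y∈ = ∈-filter⁺ (λ s → ¬? (s ≟ₛ T)) (shadows (G′⊆G e∈) y∈)
    (λ e-y≡T → proj₂ (∈-filter⁻ (λ e → ¬? (T ⊆? e)) {xs = G} e∈) (subst (_⊆ e) e-y≡T (p─q⊆p e ⁅ y ⁆)))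
  rest-bound : length G′ ≤ (K ∸ 1) * length S′
  rest-bound = degenerate-bound S′ G′ (smaller S′<S) (Unique.filter⁺ (λ e → ¬? (T ⊆? e)) G-unique) G′-shadows
                 (λ H⊆G′ → degenerate (λ E∈ → G′⊆G (H⊆G′ E∈)))

cycle-room : ∀ {k ℓ} → 3 ≤ k → 3 ≤ ℓ → 2 + (ℓ + ℓ * (k ∸ 2)) ≤ k * ℓ
cycle-room {suc (suc d)} {ℓ} (s≤s (s≤s _)) 3≤ℓ = begin
  2 + (ℓ + ℓ * d)    ≡⟨ sym (+-assoc 2 ℓ (ℓ * d)) ⟩
  (2 + ℓ) + ℓ * d    ≡⟨ cong (_+ ℓ * d) (+-comm 2 ℓ) ⟩
  (ℓ + 2) + ℓ * d    ≡⟨ +-assoc ℓ 2 (ℓ * d) ⟩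
  ℓ + (2 + ℓ * d)    ≤⟨ +-monoʳ-≤ ℓ (+-mono-≤ (≤-trans (n≤1+n 2) 3≤ℓ) (≤-reflexive (*-comm ℓ d))) ⟩
  ℓ + (ℓ + d * ℓ)    ∎
  where open ≤-Reasoning

-- A k-uniform family without a linear ℓ-cycle is kℓ-degenerate: a subfamily in which
-- every set E - x lies in at least kℓ edges would contain a linear ℓ-cycle.
cycle-free-degenerate : ∀ {n k ℓ} (G : List (Subset n)) → All (λ E → ∣ E ∣ ≡ k) G → 3 ≤ k → 3 ≤ ℓ →
  ¬ LinearCycleIn ℓ G → Degenerate (k * ℓ) G
cycle-free-degenerate {n} {k} {ℓ} G G-uniform 3≤k 3≤ℓ cycle-free {H} H⊆G H-unique E∈H
  with any? (λ E → FinP.any? (λ x → (x ∈? E) ×-dec (degree H (E - x) <? k * ℓ))) H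
... | yes sparse = let (E , E∈ , x , x∈ , small) = find sparse in E , x , E∈ , x∈ , small
... | no none =
  ⊥-elim (cycle-free (LinearCycleIn-mono H⊆G (Dense.dense-cycle H H-unique H-uniform H-dense E∈H 3≤k 3≤ℓ (cycle-room 3≤k 3≤ℓ))))
  where
  H-uniform : All (λ E → ∣ E ∣ ≡ k) H
  H-uniform = All.tabulate (λ E∈ → All.lookup G-uniform (H⊆G E∈))
  H-dense : ∀ {E} → E ∈ₗ H → ∀ {x} → x ∈ E → k * ℓ ≤ degree H (E - x)
  H-dense E∈ x∈ = ≮⇒≥ (λ small → none (lose E∈ (_ , x∈ , small)))

corollary4p3 : (n k ℓ : ℕ) → 1 ≤ n → 3 ≤ k → 3 ≤ ℓ →
    (𝓕 : Family n k) → ¬ ContainsLinearCycle ℓ 𝓕 →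
      length (edges 𝓕) ≤ (k * ℓ ∸ 1) * (n C (k ∸ 1))
corollary4p3 n k ℓ _ 3≤k 3≤ℓ 𝓕 cycle-free = begin
  length (edges 𝓕)                ≤⟨ degenerate-bound S (edges 𝓕) (<-wellFounded (length S)) (distinct 𝓕)
                                        shadows (cycle-free-degenerate (edges 𝓕) (uniform 𝓕) 3≤k 3≤ℓ cycle-free) ⟩
  (k * ℓ ∸ 1) * length S          ≡⟨ cong ((k * ℓ ∸ 1) *_) (length-subsets n (k ∸ 1)) ⟩
  (k * ℓ ∸ 1) * (n C (k ∸ 1))     ∎
  where
  open ≤-Reasoning
  S : List (Subset n)
  S = subsets n (k ∸ 1)
  shadows : ShadowsIn S (edges 𝓕)
  shadows E∈ x∈ = ∈-subsets (k ∸ 1) _ (cong (_∸ 1) (trans (sym (card-remove x∈)) (All.lookup (uniform 𝓕) E∈)))
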